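{- Let $t$ be a lambda-term in $\beta$-normal form. Then $[\![T]\!](t) = [\![T']\!](t)$, i.e. the translations induced by Turner's algorithm $T$ (given by recursive equations with side conditions) and by its variant $T'$ (given by optimisation rules) produce syntactically identical combinatory terms on $t$.
   Context: Lambda-terms are considered up to $\alpha$-equivalence; $\mathrm{FV}(t)$ is the set of free variables of $t$. Fix the closed lambda-terms (combinators) $\mathsf{S}=\lambda xyz.xz(yz)$, $\mathsf{K}=\lambda xy.x$, $\mathsf{I}=\lambda x.x$, $\mathsf{B}=\lambda xyz.x(yz)$, $\mathsf{C}=\lambda xyz.xzy$, $\mathsf{S}'=\lambda kxyz.k(xz)(yz)$, $\mathsf{B}'=\lambda kxyz.kx(yz)$, $\mathsf{C}'=\lambda kxyz.k(xz)y$. Let $\mathcal{B}=\{\mathsf{S},\mathsf{K},\mathsf{I},\mathsf{B},\mathsf{C},\mathsf{S}',\mathsf{B}',\mathsf{C}'\}$ and let $\mathrm{CL}(\mathcal{B})$ be the set of terms built from variables and elements of $\mathcal{B}$ using only application (application associates to the left). Equality of such terms is syntactic identity, the combinators being treated as atoms. Algorithm $T$: for a variable $x$ and $t\in\mathrm{CL}(\mathcal{B})$, $[x]_T t$ is given by the first applicable equation in the list: (1) $[x]_T t=\mathsf{K}t$ if $x\notin\mathrm{FV}(t)$; (2) $[x]_T x=\mathsf{I}$; (3) $[x]_T (s x)=s$ if $x\notin\mathrm{FV}(s)$; (4) $[x]_T (u x t)=\mathsf{C}ut$ if $x\notin\mathrm{FV}(ut)$; (5) $[x]_T (u x t)=\mathsf{S}u([x]_T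 t)$ if $x\notin\mathrm{FV}(u)$; (6) $[x]_T (u s t)=\mathsf{B}'us([x]_T t)$ if $x\notin\mathrm{FV}(us)$; (7) $[x]_T (u s t)=\mathsf{C}'u([x]_T s)t$ if $x\notin\mathrm{FV}(ut)$; (8) $[x]_T (u s t)=\mathsf{S}'u([x]_T s)([x]_T t)$ if $x\notin\mathrm{FV}(u)$; (9) $[x]_T (s t)=\mathsf{B}s([x]_T t)$ if $x\notin\mathrm{FV}(s)$; (10) $[x]_T (s t)=\mathsf{C}([x]_T s)t$ if $x\notin\mathrm{FV}(t)$; (11) $[x]_T (s t)=\mathsf{S}([x]_T s)([x]_T t)$. Algorithm $T'$: $[x]_{T'}(st)=\mathrm{Opt}(\mathsf{S}([x]_{T'}s)([x]_{T'}t))$; $[x]_{T'}x=\mathsf{I}$; $[x]_{T'}t=\mathsf{K}t$ otherwise (i.e. for $t$ a variable other than $x$ or a constant), earlier equations taking precedence. Here $\mathrm{Opt}$ is defined by the first applicable clause: (1) $\mathrm{Opt}(\mathsf{S}(\mathsf{K}s)(\mathsf{K}t))=\mathsf{K}(st)$; (2) $\mathrm{Opt}(\mathsf{S}(\mathsf{K}s)\mathsf{I})=s$; (3) $\mathrm{Opt}(\mathsf{S}(\mathsf{K}(us))t)=\mathsf{B}'ust$; (4) $\mathrm{Opt}(\mathsf{S}(\mathsf{K}s)t)=\mathsf{B}st$; (5) $\mathrm{Opt}(\mathsf{S}(\mathsf{B}us)(\mathsf{K}t))=\mathsf{C}'ust$; (6) $\mathrm{Opt}(\mathsf{S}(\mathsf{B}'u_1u_2s)(\mathsf{K}t))=\mathsf{C}'(u_1u_2)st$;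 (7) $\mathrm{Opt}(\mathsf{S}s(\mathsf{K}t))=\mathsf{C}st$; (8) $\mathrm{Opt}(\mathsf{S}(\mathsf{B}us)t)=\mathsf{S}'ust$; (9) $\mathrm{Opt}(\mathsf{S}(\mathsf{B}'u_1u_2s)t)=\mathsf{S}'(u_1u_2)st$; (10) $\mathrm{Opt}(\mathsf{S}st)=\mathsf{S}st$. For an abstraction algorithm $A$ the induced translation $[\![A]\!]$ from lambda-terms to $\mathrm{CL}(\mathcal{B})$ is defined by $[\![A]\!](x)=x$, $[\![A]\!](st)=[\![A]\!](s)\,[\![A]\!](t)$, $[\![A]\!](\lambda x.t)=[x]_A([\![A]\!](t))$. -}

module Defs where

open import Data.Nat using (ℕ; _≡ᵇ_)
open import Data.Bool using (Bool; true; false; not; _∧_; _∨_; if_then_else_)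
open import Relation.Binary.PropositionalEquality using (_≡_)

Var : Set
Var = ℕ

-- The translations below produce
-- binder-free combinatory terms, so they are invariant under
-- alpha-conversion; quantifying over all named terms covers every
-- alpha-equivalence class.

data Λ : Set where
  var : Var → Λ
  _·_ : Λ → Λ → Λ
  lam : Var → Λ → Λ

infixl 7 _·_

mutual
  data Neutral : Λ → Set where
    ne-var : ∀ x → Neutral (var x)
    ne-app : ∀ {s t} → Neutral s → Normal t → Neutral (s · t)

  data Normal : Λ → Set where
    nf-ne  : ∀ {t} → Neutral t → Normal t
    nf-lam : ∀ x {t} → Normal t → Normal (lam x t)

data Comb : Set where
  `S `K `I `B `C `S' `B' `C' : Comb

data CL : Set where
  v   : Var → CL
  c   : Comb → CL
  _∙_ : CL → CL → CL

infixl 7 _∙_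

occ : Var → CL → Bool
occ x (v y)   = x ≡ᵇ y
occ x (c _)   = false
occ x (s ∙ t) = occ x s ∨ occ x t

isVar : Var → CL → Bool
isVar x (v y)   = x ≡ᵇ y
isVar x (c _)   = false
isVar x (_ ∙ _) = false

-- Turner's algorithm T: [x]_T t, first applicable equation (1)-(11).

mutual
  absT : Var → CL → CL
  absT x t = if not (occ x t) then c `K ∙ t else absT-occ x t   -- (1)

  -- here x ∈ FV(t)
  absT-occ : Var → CL → CL
  absT-occ x (v y)   = c `I                                      -- (2)
  absT-occ x (c k)   = c `K ∙ c k                                -- unreachable
  absT-occ x (s ∙ t) =
    if isVar x t ∧ not (occ x s) then s                          -- (3)
    else absT-app2 x s t

  absT-app2 : Var → CL → CL → CL
  absT-app2 x (u ∙ s) t =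
    if isVar x s ∧ not (occ x u ∨ occ x t) then c `C ∙ u ∙ t                         -- (4)
    else if isVar x s ∧ not (occ x u) then c `S ∙ u ∙ absT x t                       -- (5)
    else if not (occ x u ∨ occ x s) then c `B' ∙ u ∙ s ∙ absT x t                    -- (6)
    else if not (occ x u ∨ occ x t) then c `C' ∙ u ∙ absT x s ∙ t                    -- (7)
    else if not (occ x u) then c `S' ∙ u ∙ absT x s ∙ absT x t                       -- (8)
    else absT-app1 x (u ∙ s) t
  absT-app2 x s t = absT-app1 x s t

  absT-app1 : Var → CL → CL → CL
  absT-app1 x s t =
    if not (occ x s) then c `B ∙ s ∙ absT x t                    -- (9)
    else if not (occ x t) then c `C ∙ absT x s ∙ t               -- (10)
    else c `S ∙ absT x s ∙ absT x t                              -- (11)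

Opt : CL → CL
Opt (c `S ∙ (c `K ∙ s) ∙ (c `K ∙ t))           = c `K ∙ (s ∙ t)               -- (1)
Opt (c `S ∙ (c `K ∙ s) ∙ c `I)                 = s                            -- (2)
Opt (c `S ∙ (c `K ∙ (u ∙ s)) ∙ t)              = c `B' ∙ u ∙ s ∙ t            -- (3)
Opt (c `S ∙ (c `K ∙ s) ∙ t)                    = c `B ∙ s ∙ t                 -- (4)
Opt (c `S ∙ (c `B ∙ u ∙ s) ∙ (c `K ∙ t))       = c `C' ∙ u ∙ s ∙ t            -- (5)
Opt (c `S ∙ (c `B' ∙ u₁ ∙ u₂ ∙ s) ∙ (c `K ∙ t)) = c `C' ∙ (u₁ ∙ u₂) ∙ s ∙ t   -- (6)
Opt (c `S ∙ s ∙ (c `K ∙ t))                    = c `C ∙ s ∙ t                 -- (7)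
Opt (c `S ∙ (c `B ∙ u ∙ s) ∙ t)                = c `S' ∙ u ∙ s ∙ t            -- (8)
Opt (c `S ∙ (c `B' ∙ u₁ ∙ u₂ ∙ s) ∙ t)         = c `S' ∙ (u₁ ∙ u₂) ∙ s ∙ t    -- (9)
Opt t                                          = t                            -- (10)

absT' : Var → CL → CL
absT' x (s ∙ t) = Opt (c `S ∙ absT' x s ∙ absT' x t)
absT' x (v y)   = if x ≡ᵇ y then c `I else c `K ∙ v y
absT' x (c k)   = c `K ∙ c k

⟦_⟧[_] : Λ → (Var → CL → CL) → CL
⟦ var x ⟧[ A ]   = v x
⟦ s · t ⟧[ A ]   = ⟦ s ⟧[ A ] ∙ ⟦ t ⟧[ A ]
⟦ lam x t ⟧[ A ] = A x ⟦ t ⟧[ A ]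

⟦T⟧ : Λ → CL
⟦T⟧ t = ⟦ t ⟧[ absT ]

⟦T'⟧ : Λ → CL
⟦T'⟧ t = ⟦ t ⟧[ absT' ]

module Submission where

-- For an application s t, T′ computes Opt (S [x]s [x]t), and each equation (1)–(11) of T is
-- reproduced by a clause of Opt once the shapes of [x]s and [x]t are known: [x]t is K t exactly
-- when x ∉ FV t, and otherwise it is neither K _ nor (unless t = x) I; the terms B′ u s _ and
-- B s _ produced by rules (6)/(9) are exactly what Opt's clauses (5)/(6) and (8)/(9) turn into
-- the C′ and S′ of rules (7)/(8). The only danger is the η-rule (3), [x](s x) = s: were s itself
-- I, K a, B a b or B′ a b c, Opt would rewrite the enclosing term further. So the comparison is
-- made for Good terms, in which no term of these four shapes is applied to a variable.
-- Translations of β-normal forms are Good, since there every application to a variable has a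
-- variable at its head, and [x]_T preserves Good.

open import Defs
open import Data.Bool using (Bool; true; false; not; _∧_; _∨_; if_then_else_)
open import Data.Bool.Properties using (∨-conicalˡ; ∨-conicalʳ; ∧-conicalˡ)
open import Data.Nat using (_≡ᵇ_)
open import Data.Product using (_×_; _,_; proj₂)
open import Data.Unit using (⊤; tt)
open import Relation.Binary.PropositionalEquality using (_≡_; refl; sym; trans; cong; cong₂)
open Relation.Binary.PropositionalEquality.≡-Reasoning

isI : CL → Bool
isI (c `I) = true
isI _      = false

isKApp : CL → Bool
isKApp (c `K ∙ _) = true
isKApp _          = false

isKOrI : CL → Bool
isKOrI b = isKApp b ∨ isI b

isBApp : CL → Bool
isBApp (c `B ∙ _ ∙ _)      = true
isBApp (c `B' ∙ _ ∙ _ ∙ _) = true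
isBApp _                   = false

-- The shapes of a that some clause of Opt inspects in S a b.
optRedexˡ : CL → Bool
optRedexˡ a = isKApp a ∨ isBApp a

optS : CL → CL → CL
optS a b = Opt (c `S ∙ a ∙ b)

-- The common output of T's rules (6)/(9) and of Opt's clauses (3)/(4).
composeB : CL → CL → CL
composeB (u ∙ s) b = c `B' ∙ u ∙ s ∙ b
composeB s       b = c `B ∙ s ∙ b

-- Opt computes only once its argument is unfolded as deeply as its clauses look, which is what
-- forces the exhaustive case splits below.
Opt-S : ∀ a b → optRedexˡ a ≡ false → isKApp b ≡ false → optS a b ≡ c `S ∙ a ∙ b
Opt-S (v y) (v y') _ _ = refl
Opt-S (v y) (c k') _ _ = refl
Opt-S (v y) (v y' ∙ t) _ _ = refl
Opt-S (v y) (c `S ∙ t) _ _ = refl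
Opt-S (v y) (c `K ∙ t) _ ()
Opt-S (v y) (c `I ∙ t) _ _ = refl
Opt-S (v y) (c `B ∙ t) _ _ = refl
Opt-S (v y) (c `C ∙ t) _ _ = refl
Opt-S (v y) (c `S' ∙ t) _ _ = refl
Opt-S (v y) (c `B' ∙ t) _ _ = refl
Opt-S (v y) (c `C' ∙ t) _ _ = refl
Opt-S (v y) (t₁ ∙ t₂ ∙ t) _ _ = refl
Opt-S (c k) (v y') _ _ = refl
Opt-S (c k) (c k') _ _ = refl
Opt-S (c k) (v y' ∙ t) _ _ = refl
Opt-S (c k) (c `S ∙ t) _ _ = refl
Opt-S (c k) (c `K ∙ t) _ ()
Opt-S (c k) (c `I ∙ t) _ _ = refl
Opt-S (c k) (c `B ∙ t) _ _ = refl
Opt-S (c k) (c `C ∙ t) _ _ = refl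
Opt-S (c k) (c `S' ∙ t) _ _ = refl
Opt-S (c k) (c `B' ∙ t) _ _ = refl
Opt-S (c k) (c `C' ∙ t) _ _ = refl
Opt-S (c k) (t₁ ∙ t₂ ∙ t) _ _ = refl
Opt-S (v y ∙ q) (v y') _ _ = refl
Opt-S (v y ∙ q) (c k') _ _ = refl
Opt-S (v y ∙ q) (v y' ∙ t) _ _ = refl
Opt-S (v y ∙ q) (c `S ∙ t) _ _ = refl
Opt-S (v y ∙ q) (c `K ∙ t) _ ()
Opt-S (v y ∙ q) (c `I ∙ t) _ _ = refl
Opt-S (v y ∙ q) (c `B ∙ t) _ _ = refl
Opt-S (v y ∙ q) (c `C ∙ t) _ _ = refl
Opt-S (v y ∙ q) (c `S' ∙ t) _ _ = refl
Opt-S (v y ∙ q) (c `B' ∙ t) _ _ = refl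
Opt-S (v y ∙ q) (c `C' ∙ t) _ _ = refl
Opt-S (v y ∙ q) (t₁ ∙ t₂ ∙ t) _ _ = refl
Opt-S (c `S ∙ q) (v y') _ _ = refl
Opt-S (c `S ∙ q) (c k') _ _ = refl
Opt-S (c `S ∙ q) (v y' ∙ t) _ _ = refl
Opt-S (c `S ∙ q) (c `S ∙ t) _ _ = refl
Opt-S (c `S ∙ q) (c `K ∙ t) _ ()
Opt-S (c `S ∙ q) (c `I ∙ t) _ _ = refl
Opt-S (c `S ∙ q) (c `B ∙ t) _ _ = refl
Opt-S (c `S ∙ q) (c `C ∙ t) _ _ = refl
Opt-S (c `S ∙ q) (c `S' ∙ t) _ _ = refl
Opt-S (c `S ∙ q) (c `B' ∙ t) _ _ = refl
Opt-S (c `S ∙ q) (c `C' ∙ t) _ _ = refl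
Opt-S (c `S ∙ q) (t₁ ∙ t₂ ∙ t) _ _ = refl
Opt-S (c `K ∙ q) b () _
Opt-S (c `I ∙ q) (v y') _ _ = refl
Opt-S (c `I ∙ q) (c k') _ _ = refl
Opt-S (c `I ∙ q) (v y' ∙ t) _ _ = refl
Opt-S (c `I ∙ q) (c `S ∙ t) _ _ = refl
Opt-S (c `I ∙ q) (c `K ∙ t) _ ()
Opt-S (c `I ∙ q) (c `I ∙ t) _ _ = refl
Opt-S (c `I ∙ q) (c `B ∙ t) _ _ = refl
Opt-S (c `I ∙ q) (c `C ∙ t) _ _ = refl
Opt-S (c `I ∙ q) (c `S' ∙ t) _ _ = refl
Opt-S (c `I ∙ q) (c `B' ∙ t) _ _ = refl
Opt-S (c `I ∙ q) (c `C' ∙ t) _ _ = refl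
Opt-S (c `I ∙ q) (t₁ ∙ t₂ ∙ t) _ _ = refl
Opt-S (c `B ∙ q) (v y') _ _ = refl
Opt-S (c `B ∙ q) (c k') _ _ = refl
Opt-S (c `B ∙ q) (v y' ∙ t) _ _ = refl
Opt-S (c `B ∙ q) (c `S ∙ t) _ _ = refl
Opt-S (c `B ∙ q) (c `K ∙ t) _ ()
Opt-S (c `B ∙ q) (c `I ∙ t) _ _ = refl
Opt-S (c `B ∙ q) (c `B ∙ t) _ _ = refl
Opt-S (c `B ∙ q) (c `C ∙ t) _ _ = refl
Opt-S (c `B ∙ q) (c `S' ∙ t) _ _ = refl
Opt-S (c `B ∙ q) (c `B' ∙ t) _ _ = refl
Opt-S (c `B ∙ q) (c `C' ∙ t) _ _ = refl
Opt-S (c `B ∙ q) (t₁ ∙ t₂ ∙ t) _ _ = refl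
Opt-S (c `C ∙ q) (v y') _ _ = refl
Opt-S (c `C ∙ q) (c k') _ _ = refl
Opt-S (c `C ∙ q) (v y' ∙ t) _ _ = refl
Opt-S (c `C ∙ q) (c `S ∙ t) _ _ = refl
Opt-S (c `C ∙ q) (c `K ∙ t) _ ()
Opt-S (c `C ∙ q) (c `I ∙ t) _ _ = refl
Opt-S (c `C ∙ q) (c `B ∙ t) _ _ = refl
Opt-S (c `C ∙ q) (c `C ∙ t) _ _ = refl
Opt-S (c `C ∙ q) (c `S' ∙ t) _ _ = refl
Opt-S (c `C ∙ q) (c `B' ∙ t) _ _ = refl
Opt-S (c `C ∙ q) (c `C' ∙ t) _ _ = refl
Opt-S (c `C ∙ q) (t₁ ∙ t₂ ∙ t) _ _ = refl
Opt-S (c `S' ∙ q) (v y') _ _ = refl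
Opt-S (c `S' ∙ q) (c k') _ _ = refl
Opt-S (c `S' ∙ q) (v y' ∙ t) _ _ = refl
Opt-S (c `S' ∙ q) (c `S ∙ t) _ _ = refl
Opt-S (c `S' ∙ q) (c `K ∙ t) _ ()
Opt-S (c `S' ∙ q) (c `I ∙ t) _ _ = refl
Opt-S (c `S' ∙ q) (c `B ∙ t) _ _ = refl
Opt-S (c `S' ∙ q) (c `C ∙ t) _ _ = refl
Opt-S (c `S' ∙ q) (c `S' ∙ t) _ _ = refl
Opt-S (c `S' ∙ q) (c `B' ∙ t) _ _ = refl
Opt-S (c `S' ∙ q) (c `C' ∙ t) _ _ = refl
Opt-S (c `S' ∙ q) (t₁ ∙ t₂ ∙ t) _ _ = refl
Opt-S (c `B' ∙ q) (v y') _ _ = refl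
Opt-S (c `B' ∙ q) (c k') _ _ = refl
Opt-S (c `B' ∙ q) (v y' ∙ t) _ _ = refl
Opt-S (c `B' ∙ q) (c `S ∙ t) _ _ = refl
Opt-S (c `B' ∙ q) (c `K ∙ t) _ ()
Opt-S (c `B' ∙ q) (c `I ∙ t) _ _ = refl
Opt-S (c `B' ∙ q) (c `B ∙ t) _ _ = refl
Opt-S (c `B' ∙ q) (c `C ∙ t) _ _ = refl
Opt-S (c `B' ∙ q) (c `S' ∙ t) _ _ = refl
Opt-S (c `B' ∙ q) (c `B' ∙ t) _ _ = refl
Opt-S (c `B' ∙ q) (c `C' ∙ t) _ _ = refl
Opt-S (c `B' ∙ q) (t₁ ∙ t₂ ∙ t) _ _ = refl
Opt-S (c `C' ∙ q) (v y') _ _ = refl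
Opt-S (c `C' ∙ q) (c k') _ _ = refl
Opt-S (c `C' ∙ q) (v y' ∙ t) _ _ = refl
Opt-S (c `C' ∙ q) (c `S ∙ t) _ _ = refl
Opt-S (c `C' ∙ q) (c `K ∙ t) _ ()
Opt-S (c `C' ∙ q) (c `I ∙ t) _ _ = refl
Opt-S (c `C' ∙ q) (c `B ∙ t) _ _ = refl
Opt-S (c `C' ∙ q) (c `C ∙ t) _ _ = refl
Opt-S (c `C' ∙ q) (c `S' ∙ t) _ _ = refl
Opt-S (c `C' ∙ q) (c `B' ∙ t) _ _ = refl
Opt-S (c `C' ∙ q) (c `C' ∙ t) _ _ = refl
Opt-S (c `C' ∙ q) (t₁ ∙ t₂ ∙ t) _ _ = refl
Opt-S (v y ∙ p ∙ q) (v y') _ _ = refl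
Opt-S (v y ∙ p ∙ q) (c k') _ _ = refl
Opt-S (v y ∙ p ∙ q) (v y' ∙ t) _ _ = refl
Opt-S (v y ∙ p ∙ q) (c `S ∙ t) _ _ = refl
Opt-S (v y ∙ p ∙ q) (c `K ∙ t) _ ()
Opt-S (v y ∙ p ∙ q) (c `I ∙ t) _ _ = refl
Opt-S (v y ∙ p ∙ q) (c `B ∙ t) _ _ = refl
Opt-S (v y ∙ p ∙ q) (c `C ∙ t) _ _ = refl
Opt-S (v y ∙ p ∙ q) (c `S' ∙ t) _ _ = refl
Opt-S (v y ∙ p ∙ q) (c `B' ∙ t) _ _ = refl
Opt-S (v y ∙ p ∙ q) (c `C' ∙ t) _ _ = refl
Opt-S (v y ∙ p ∙ q) (t₁ ∙ t₂ ∙ t) _ _ = refl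
Opt-S (c `S ∙ p ∙ q) (v y') _ _ = refl
Opt-S (c `S ∙ p ∙ q) (c k') _ _ = refl
Opt-S (c `S ∙ p ∙ q) (v y' ∙ t) _ _ = refl
Opt-S (c `S ∙ p ∙ q) (c `S ∙ t) _ _ = refl
Opt-S (c `S ∙ p ∙ q) (c `K ∙ t) _ ()
Opt-S (c `S ∙ p ∙ q) (c `I ∙ t) _ _ = refl
Opt-S (c `S ∙ p ∙ q) (c `B ∙ t) _ _ = refl
Opt-S (c `S ∙ p ∙ q) (c `C ∙ t) _ _ = refl
Opt-S (c `S ∙ p ∙ q) (c `S' ∙ t) _ _ = refl
Opt-S (c `S ∙ p ∙ q) (c `B' ∙ t) _ _ = refl
Opt-S (c `S ∙ p ∙ q) (c `C' ∙ t) _ _ = refl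
Opt-S (c `S ∙ p ∙ q) (t₁ ∙ t₂ ∙ t) _ _ = refl
Opt-S (c `K ∙ p ∙ q) (v y') _ _ = refl
Opt-S (c `K ∙ p ∙ q) (c k') _ _ = refl
Opt-S (c `K ∙ p ∙ q) (v y' ∙ t) _ _ = refl
Opt-S (c `K ∙ p ∙ q) (c `S ∙ t) _ _ = refl
Opt-S (c `K ∙ p ∙ q) (c `K ∙ t) _ ()
Opt-S (c `K ∙ p ∙ q) (c `I ∙ t) _ _ = refl
Opt-S (c `K ∙ p ∙ q) (c `B ∙ t) _ _ = refl
Opt-S (c `K ∙ p ∙ q) (c `C ∙ t) _ _ = refl
Opt-S (c `K ∙ p ∙ q) (c `S' ∙ t) _ _ = refl
Opt-S (c `K ∙ p ∙ q) (c `B' ∙ t) _ _ = refl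
Opt-S (c `K ∙ p ∙ q) (c `C' ∙ t) _ _ = refl
Opt-S (c `K ∙ p ∙ q) (t₁ ∙ t₂ ∙ t) _ _ = refl
Opt-S (c `I ∙ p ∙ q) (v y') _ _ = refl
Opt-S (c `I ∙ p ∙ q) (c k') _ _ = refl
Opt-S (c `I ∙ p ∙ q) (v y' ∙ t) _ _ = refl
Opt-S (c `I ∙ p ∙ q) (c `S ∙ t) _ _ = refl
Opt-S (c `I ∙ p ∙ q) (c `K ∙ t) _ ()
Opt-S (c `I ∙ p ∙ q) (c `I ∙ t) _ _ = refl
Opt-S (c `I ∙ p ∙ q) (c `B ∙ t) _ _ = refl
Opt-S (c `I ∙ p ∙ q) (c `C ∙ t) _ _ = refl
Opt-S (c `I ∙ p ∙ q) (c `S' ∙ t) _ _ = refl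
Opt-S (c `I ∙ p ∙ q) (c `B' ∙ t) _ _ = refl
Opt-S (c `I ∙ p ∙ q) (c `C' ∙ t) _ _ = refl
Opt-S (c `I ∙ p ∙ q) (t₁ ∙ t₂ ∙ t) _ _ = refl
Opt-S (c `B ∙ p ∙ q) b () _
Opt-S (c `C ∙ p ∙ q) (v y') _ _ = refl
Opt-S (c `C ∙ p ∙ q) (c k') _ _ = refl
Opt-S (c `C ∙ p ∙ q) (v y' ∙ t) _ _ = refl
Opt-S (c `C ∙ p ∙ q) (c `S ∙ t) _ _ = refl
Opt-S (c `C ∙ p ∙ q) (c `K ∙ t) _ ()
Opt-S (c `C ∙ p ∙ q) (c `I ∙ t) _ _ = refl
Opt-S (c `C ∙ p ∙ q) (c `B ∙ t) _ _ = refl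
Opt-S (c `C ∙ p ∙ q) (c `C ∙ t) _ _ = refl
Opt-S (c `C ∙ p ∙ q) (c `S' ∙ t) _ _ = refl
Opt-S (c `C ∙ p ∙ q) (c `B' ∙ t) _ _ = refl
Opt-S (c `C ∙ p ∙ q) (c `C' ∙ t) _ _ = refl
Opt-S (c `C ∙ p ∙ q) (t₁ ∙ t₂ ∙ t) _ _ = refl
Opt-S (c `S' ∙ p ∙ q) (v y') _ _ = refl
Opt-S (c `S' ∙ p ∙ q) (c k') _ _ = refl
Opt-S (c `S' ∙ p ∙ q) (v y' ∙ t) _ _ = refl
Opt-S (c `S' ∙ p ∙ q) (c `S ∙ t) _ _ = refl
Opt-S (c `S' ∙ p ∙ q) (c `K ∙ t) _ ()
Opt-S (c `S' ∙ p ∙ q) (c `I ∙ t) _ _ = refl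
Opt-S (c `S' ∙ p ∙ q) (c `B ∙ t) _ _ = refl
Opt-S (c `S' ∙ p ∙ q) (c `C ∙ t) _ _ = refl
Opt-S (c `S' ∙ p ∙ q) (c `S' ∙ t) _ _ = refl
Opt-S (c `S' ∙ p ∙ q) (c `B' ∙ t) _ _ = refl
Opt-S (c `S' ∙ p ∙ q) (c `C' ∙ t) _ _ = refl
Opt-S (c `S' ∙ p ∙ q) (t₁ ∙ t₂ ∙ t) _ _ = refl
Opt-S (c `B' ∙ p ∙ q) (v y') _ _ = refl
Opt-S (c `B' ∙ p ∙ q) (c k') _ _ = refl
Opt-S (c `B' ∙ p ∙ q) (v y' ∙ t) _ _ = refl
Opt-S (c `B' ∙ p ∙ q) (c `S ∙ t) _ _ = refl
Opt-S (c `B' ∙ p ∙ q) (c `K ∙ t) _ ()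
Opt-S (c `B' ∙ p ∙ q) (c `I ∙ t) _ _ = refl
Opt-S (c `B' ∙ p ∙ q) (c `B ∙ t) _ _ = refl
Opt-S (c `B' ∙ p ∙ q) (c `C ∙ t) _ _ = refl
Opt-S (c `B' ∙ p ∙ q) (c `S' ∙ t) _ _ = refl
Opt-S (c `B' ∙ p ∙ q) (c `B' ∙ t) _ _ = refl
Opt-S (c `B' ∙ p ∙ q) (c `C' ∙ t) _ _ = refl
Opt-S (c `B' ∙ p ∙ q) (t₁ ∙ t₂ ∙ t) _ _ = refl
Opt-S (c `C' ∙ p ∙ q) (v y') _ _ = refl
Opt-S (c `C' ∙ p ∙ q) (c k') _ _ = refl
Opt-S (c `C' ∙ p ∙ q) (v y' ∙ t) _ _ = refl
Opt-S (c `C' ∙ p ∙ q) (c `S ∙ t) _ _ = refl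
Opt-S (c `C' ∙ p ∙ q) (c `K ∙ t) _ ()
Opt-S (c `C' ∙ p ∙ q) (c `I ∙ t) _ _ = refl
Opt-S (c `C' ∙ p ∙ q) (c `B ∙ t) _ _ = refl
Opt-S (c `C' ∙ p ∙ q) (c `C ∙ t) _ _ = refl
Opt-S (c `C' ∙ p ∙ q) (c `S' ∙ t) _ _ = refl
Opt-S (c `C' ∙ p ∙ q) (c `B' ∙ t) _ _ = refl
Opt-S (c `C' ∙ p ∙ q) (c `C' ∙ t) _ _ = refl
Opt-S (c `C' ∙ p ∙ q) (t₁ ∙ t₂ ∙ t) _ _ = refl
Opt-S (v y ∙ r ∙ p ∙ q) (v y') _ _ = refl
Opt-S (v y ∙ r ∙ p ∙ q) (c k') _ _ = refl
Opt-S (v y ∙ r ∙ p ∙ q) (v y' ∙ t) _ _ = refl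
Opt-S (v y ∙ r ∙ p ∙ q) (c `S ∙ t) _ _ = refl
Opt-S (v y ∙ r ∙ p ∙ q) (c `K ∙ t) _ ()
Opt-S (v y ∙ r ∙ p ∙ q) (c `I ∙ t) _ _ = refl
Opt-S (v y ∙ r ∙ p ∙ q) (c `B ∙ t) _ _ = refl
Opt-S (v y ∙ r ∙ p ∙ q) (c `C ∙ t) _ _ = refl
Opt-S (v y ∙ r ∙ p ∙ q) (c `S' ∙ t) _ _ = refl
Opt-S (v y ∙ r ∙ p ∙ q) (c `B' ∙ t) _ _ = refl
Opt-S (v y ∙ r ∙ p ∙ q) (c `C' ∙ t) _ _ = refl
Opt-S (v y ∙ r ∙ p ∙ q) (t₁ ∙ t₂ ∙ t) _ _ = refl
Opt-S (c `S ∙ r ∙ p ∙ q) (v y') _ _ = refl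
Opt-S (c `S ∙ r ∙ p ∙ q) (c k') _ _ = refl
Opt-S (c `S ∙ r ∙ p ∙ q) (v y' ∙ t) _ _ = refl
Opt-S (c `S ∙ r ∙ p ∙ q) (c `S ∙ t) _ _ = refl
Opt-S (c `S ∙ r ∙ p ∙ q) (c `K ∙ t) _ ()
Opt-S (c `S ∙ r ∙ p ∙ q) (c `I ∙ t) _ _ = refl
Opt-S (c `S ∙ r ∙ p ∙ q) (c `B ∙ t) _ _ = refl
Opt-S (c `S ∙ r ∙ p ∙ q) (c `C ∙ t) _ _ = refl
Opt-S (c `S ∙ r ∙ p ∙ q) (c `S' ∙ t) _ _ = refl
Opt-S (c `S ∙ r ∙ p ∙ q) (c `B' ∙ t) _ _ = refl
Opt-S (c `S ∙ r ∙ p ∙ q) (c `C' ∙ t) _ _ = refl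
Opt-S (c `S ∙ r ∙ p ∙ q) (t₁ ∙ t₂ ∙ t) _ _ = refl
Opt-S (c `K ∙ r ∙ p ∙ q) (v y') _ _ = refl
Opt-S (c `K ∙ r ∙ p ∙ q) (c k') _ _ = refl
Opt-S (c `K ∙ r ∙ p ∙ q) (v y' ∙ t) _ _ = refl
Opt-S (c `K ∙ r ∙ p ∙ q) (c `S ∙ t) _ _ = refl
Opt-S (c `K ∙ r ∙ p ∙ q) (c `K ∙ t) _ ()
Opt-S (c `K ∙ r ∙ p ∙ q) (c `I ∙ t) _ _ = refl
Opt-S (c `K ∙ r ∙ p ∙ q) (c `B ∙ t) _ _ = refl
Opt-S (c `K ∙ r ∙ p ∙ q) (c `C ∙ t) _ _ = refl
Opt-S (c `K ∙ r ∙ p ∙ q) (c `S' ∙ t) _ _ = refl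
Opt-S (c `K ∙ r ∙ p ∙ q) (c `B' ∙ t) _ _ = refl
Opt-S (c `K ∙ r ∙ p ∙ q) (c `C' ∙ t) _ _ = refl
Opt-S (c `K ∙ r ∙ p ∙ q) (t₁ ∙ t₂ ∙ t) _ _ = refl
Opt-S (c `I ∙ r ∙ p ∙ q) (v y') _ _ = refl
Opt-S (c `I ∙ r ∙ p ∙ q) (c k') _ _ = refl
Opt-S (c `I ∙ r ∙ p ∙ q) (v y' ∙ t) _ _ = refl
Opt-S (c `I ∙ r ∙ p ∙ q) (c `S ∙ t) _ _ = refl
Opt-S (c `I ∙ r ∙ p ∙ q) (c `K ∙ t) _ ()
Opt-S (c `I ∙ r ∙ p ∙ q) (c `I ∙ t) _ _ = refl
Opt-S (c `I ∙ r ∙ p ∙ q) (c `B ∙ t) _ _ = refl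
Opt-S (c `I ∙ r ∙ p ∙ q) (c `C ∙ t) _ _ = refl
Opt-S (c `I ∙ r ∙ p ∙ q) (c `S' ∙ t) _ _ = refl
Opt-S (c `I ∙ r ∙ p ∙ q) (c `B' ∙ t) _ _ = refl
Opt-S (c `I ∙ r ∙ p ∙ q) (c `C' ∙ t) _ _ = refl
Opt-S (c `I ∙ r ∙ p ∙ q) (t₁ ∙ t₂ ∙ t) _ _ = refl
Opt-S (c `B ∙ r ∙ p ∙ q) (v y') _ _ = refl
Opt-S (c `B ∙ r ∙ p ∙ q) (c k') _ _ = refl
Opt-S (c `B ∙ r ∙ p ∙ q) (v y' ∙ t) _ _ = refl
Opt-S (c `B ∙ r ∙ p ∙ q) (c `S ∙ t) _ _ = refl
Opt-S (c `B ∙ r ∙ p ∙ q) (c `K ∙ t) _ ()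
Opt-S (c `B ∙ r ∙ p ∙ q) (c `I ∙ t) _ _ = refl
Opt-S (c `B ∙ r ∙ p ∙ q) (c `B ∙ t) _ _ = refl
Opt-S (c `B ∙ r ∙ p ∙ q) (c `C ∙ t) _ _ = refl
Opt-S (c `B ∙ r ∙ p ∙ q) (c `S' ∙ t) _ _ = refl
Opt-S (c `B ∙ r ∙ p ∙ q) (c `B' ∙ t) _ _ = refl
Opt-S (c `B ∙ r ∙ p ∙ q) (c `C' ∙ t) _ _ = refl
Opt-S (c `B ∙ r ∙ p ∙ q) (t₁ ∙ t₂ ∙ t) _ _ = refl
Opt-S (c `C ∙ r ∙ p ∙ q) (v y') _ _ = refl
Opt-S (c `C ∙ r ∙ p ∙ q) (c k') _ _ = refl
Opt-S (c `C ∙ r ∙ p ∙ q) (v y' ∙ t) _ _ = refl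
Opt-S (c `C ∙ r ∙ p ∙ q) (c `S ∙ t) _ _ = refl
Opt-S (c `C ∙ r ∙ p ∙ q) (c `K ∙ t) _ ()
Opt-S (c `C ∙ r ∙ p ∙ q) (c `I ∙ t) _ _ = refl
Opt-S (c `C ∙ r ∙ p ∙ q) (c `B ∙ t) _ _ = refl
Opt-S (c `C ∙ r ∙ p ∙ q) (c `C ∙ t) _ _ = refl
Opt-S (c `C ∙ r ∙ p ∙ q) (c `S' ∙ t) _ _ = refl
Opt-S (c `C ∙ r ∙ p ∙ q) (c `B' ∙ t) _ _ = refl
Opt-S (c `C ∙ r ∙ p ∙ q) (c `C' ∙ t) _ _ = refl
Opt-S (c `C ∙ r ∙ p ∙ q) (t₁ ∙ t₂ ∙ t) _ _ = refl
Opt-S (c `S' ∙ r ∙ p ∙ q) (v y') _ _ = refl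
Opt-S (c `S' ∙ r ∙ p ∙ q) (c k') _ _ = refl
Opt-S (c `S' ∙ r ∙ p ∙ q) (v y' ∙ t) _ _ = refl
Opt-S (c `S' ∙ r ∙ p ∙ q) (c `S ∙ t) _ _ = refl
Opt-S (c `S' ∙ r ∙ p ∙ q) (c `K ∙ t) _ ()
Opt-S (c `S' ∙ r ∙ p ∙ q) (c `I ∙ t) _ _ = refl
Opt-S (c `S' ∙ r ∙ p ∙ q) (c `B ∙ t) _ _ = refl
Opt-S (c `S' ∙ r ∙ p ∙ q) (c `C ∙ t) _ _ = refl
Opt-S (c `S' ∙ r ∙ p ∙ q) (c `S' ∙ t) _ _ = refl
Opt-S (c `S' ∙ r ∙ p ∙ q) (c `B' ∙ t) _ _ = refl
Opt-S (c `S' ∙ r ∙ p ∙ q) (c `C' ∙ t) _ _ = refl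
Opt-S (c `S' ∙ r ∙ p ∙ q) (t₁ ∙ t₂ ∙ t) _ _ = refl
Opt-S (c `B' ∙ r ∙ p ∙ q) b () _
Opt-S (c `C' ∙ r ∙ p ∙ q) (v y') _ _ = refl
Opt-S (c `C' ∙ r ∙ p ∙ q) (c k') _ _ = refl
Opt-S (c `C' ∙ r ∙ p ∙ q) (v y' ∙ t) _ _ = refl
Opt-S (c `C' ∙ r ∙ p ∙ q) (c `S ∙ t) _ _ = refl
Opt-S (c `C' ∙ r ∙ p ∙ q) (c `K ∙ t) _ ()
Opt-S (c `C' ∙ r ∙ p ∙ q) (c `I ∙ t) _ _ = refl
Opt-S (c `C' ∙ r ∙ p ∙ q) (c `B ∙ t) _ _ = refl
Opt-S (c `C' ∙ r ∙ p ∙ q) (c `C ∙ t) _ _ = refl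
Opt-S (c `C' ∙ r ∙ p ∙ q) (c `S' ∙ t) _ _ = refl
Opt-S (c `C' ∙ r ∙ p ∙ q) (c `B' ∙ t) _ _ = refl
Opt-S (c `C' ∙ r ∙ p ∙ q) (c `C' ∙ t) _ _ = refl
Opt-S (c `C' ∙ r ∙ p ∙ q) (t₁ ∙ t₂ ∙ t) _ _ = refl
Opt-S (w ∙ z ∙ r ∙ p ∙ q) (v y') _ _ = refl
Opt-S (w ∙ z ∙ r ∙ p ∙ q) (c k') _ _ = refl
Opt-S (w ∙ z ∙ r ∙ p ∙ q) (v y' ∙ t) _ _ = refl
Opt-S (w ∙ z ∙ r ∙ p ∙ q) (c `S ∙ t) _ _ = refl
Opt-S (w ∙ z ∙ r ∙ p ∙ q) (c `K ∙ t) _ ()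
Opt-S (w ∙ z ∙ r ∙ p ∙ q) (c `I ∙ t) _ _ = refl
Opt-S (w ∙ z ∙ r ∙ p ∙ q) (c `B ∙ t) _ _ = refl
Opt-S (w ∙ z ∙ r ∙ p ∙ q) (c `C ∙ t) _ _ = refl
Opt-S (w ∙ z ∙ r ∙ p ∙ q) (c `S' ∙ t) _ _ = refl
Opt-S (w ∙ z ∙ r ∙ p ∙ q) (c `B' ∙ t) _ _ = refl
Opt-S (w ∙ z ∙ r ∙ p ∙ q) (c `C' ∙ t) _ _ = refl
Opt-S (w ∙ z ∙ r ∙ p ∙ q) (t₁ ∙ t₂ ∙ t) _ _ = refl

Opt-C : ∀ a t → optRedexˡ a ≡ false → optS a (c `K ∙ t) ≡ c `C ∙ a ∙ t
Opt-C (v y) t _ = refl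
Opt-C (c k) t _ = refl
Opt-C (v y ∙ q) t _ = refl
Opt-C (c `S ∙ q) t _ = refl
Opt-C (c `K ∙ q) t ()
Opt-C (c `I ∙ q) t _ = refl
Opt-C (c `B ∙ q) t _ = refl
Opt-C (c `C ∙ q) t _ = refl
Opt-C (c `S' ∙ q) t _ = refl
Opt-C (c `B' ∙ q) t _ = refl
Opt-C (c `C' ∙ q) t _ = refl
Opt-C (v y ∙ p ∙ q) t _ = refl
Opt-C (c `S ∙ p ∙ q) t _ = refl
Opt-C (c `K ∙ p ∙ q) t _ = refl
Opt-C (c `I ∙ p ∙ q) t _ = refl
Opt-C (c `B ∙ p ∙ q) t ()
Opt-C (c `C ∙ p ∙ q) t _ = refl
Opt-C (c `S' ∙ p ∙ q) t _ = refl
Opt-C (c `B' ∙ p ∙ q) t _ = refl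
Opt-C (c `C' ∙ p ∙ q) t _ = refl
Opt-C (v y ∙ r ∙ p ∙ q) t _ = refl
Opt-C (c `S ∙ r ∙ p ∙ q) t _ = refl
Opt-C (c `K ∙ r ∙ p ∙ q) t _ = refl
Opt-C (c `I ∙ r ∙ p ∙ q) t _ = refl
Opt-C (c `B ∙ r ∙ p ∙ q) t _ = refl
Opt-C (c `C ∙ r ∙ p ∙ q) t _ = refl
Opt-C (c `S' ∙ r ∙ p ∙ q) t _ = refl
Opt-C (c `B' ∙ r ∙ p ∙ q) t ()
Opt-C (c `C' ∙ r ∙ p ∙ q) t _ = refl
Opt-C (w ∙ z ∙ r ∙ p ∙ q) t _ = refl

Opt-B : ∀ s b → isKOrI b ≡ false → optS (c `K ∙ s) b ≡ composeB s b
Opt-B (u ∙ s) (v y') _ = refl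
Opt-B (u ∙ s) (c `S) _ = refl
Opt-B (u ∙ s) (c `K) _ = refl
Opt-B (u ∙ s) (c `I) ()
Opt-B (u ∙ s) (c `B) _ = refl
Opt-B (u ∙ s) (c `C) _ = refl
Opt-B (u ∙ s) (c `S') _ = refl
Opt-B (u ∙ s) (c `B') _ = refl
Opt-B (u ∙ s) (c `C') _ = refl
Opt-B (u ∙ s) (v y' ∙ t) _ = refl
Opt-B (u ∙ s) (c `S ∙ t) _ = refl
Opt-B (u ∙ s) (c `K ∙ t) ()
Opt-B (u ∙ s) (c `I ∙ t) _ = refl
Opt-B (u ∙ s) (c `B ∙ t) _ = refl
Opt-B (u ∙ s) (c `C ∙ t) _ = refl
Opt-B (u ∙ s) (c `S' ∙ t) _ = refl
Opt-B (u ∙ s) (c `B' ∙ t) _ = refl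
Opt-B (u ∙ s) (c `C' ∙ t) _ = refl
Opt-B (u ∙ s) (t₁ ∙ t₂ ∙ t) _ = refl
Opt-B (v y) (v y') _ = refl
Opt-B (v y) (c `S) _ = refl
Opt-B (v y) (c `K) _ = refl
Opt-B (v y) (c `I) ()
Opt-B (v y) (c `B) _ = refl
Opt-B (v y) (c `C) _ = refl
Opt-B (v y) (c `S') _ = refl
Opt-B (v y) (c `B') _ = refl
Opt-B (v y) (c `C') _ = refl
Opt-B (v y) (v y' ∙ t) _ = refl
Opt-B (v y) (c `S ∙ t) _ = refl
Opt-B (v y) (c `K ∙ t) ()
Opt-B (v y) (c `I ∙ t) _ = refl
Opt-B (v y) (c `B ∙ t) _ = refl
Opt-B (v y) (c `C ∙ t) _ = refl
Opt-B (v y) (c `S' ∙ t) _ = refl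
Opt-B (v y) (c `B' ∙ t) _ = refl
Opt-B (v y) (c `C' ∙ t) _ = refl
Opt-B (v y) (t₁ ∙ t₂ ∙ t) _ = refl
Opt-B (c k) (v y') _ = refl
Opt-B (c k) (c `S) _ = refl
Opt-B (c k) (c `K) _ = refl
Opt-B (c k) (c `I) ()
Opt-B (c k) (c `B) _ = refl
Opt-B (c k) (c `C) _ = refl
Opt-B (c k) (c `S') _ = refl
Opt-B (c k) (c `B') _ = refl
Opt-B (c k) (c `C') _ = refl
Opt-B (c k) (v y' ∙ t) _ = refl
Opt-B (c k) (c `S ∙ t) _ = refl
Opt-B (c k) (c `K ∙ t) ()
Opt-B (c k) (c `I ∙ t) _ = refl
Opt-B (c k) (c `B ∙ t) _ = refl
Opt-B (c k) (c `C ∙ t) _ = refl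
Opt-B (c k) (c `S' ∙ t) _ = refl
Opt-B (c k) (c `B' ∙ t) _ = refl
Opt-B (c k) (c `C' ∙ t) _ = refl
Opt-B (c k) (t₁ ∙ t₂ ∙ t) _ = refl

Opt-C' : ∀ u a t → optS (composeB u a) (c `K ∙ t) ≡ c `C' ∙ u ∙ a ∙ t
Opt-C' (u₁ ∙ u₂) a t = refl
Opt-C' (v y) a t = refl
Opt-C' (c k) a t = refl

Opt-S' : ∀ u a b → isKApp b ≡ false → optS (composeB u a) b ≡ c `S' ∙ u ∙ a ∙ b
Opt-S' (u₁ ∙ u₂) a (v y') _ = refl
Opt-S' (u₁ ∙ u₂) a (c k') _ = refl
Opt-S' (u₁ ∙ u₂) a (v y' ∙ t) _ = refl
Opt-S' (u₁ ∙ u₂) a (c `S ∙ t) _ = refl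
Opt-S' (u₁ ∙ u₂) a (c `K ∙ t) ()
Opt-S' (u₁ ∙ u₂) a (c `I ∙ t) _ = refl
Opt-S' (u₁ ∙ u₂) a (c `B ∙ t) _ = refl
Opt-S' (u₁ ∙ u₂) a (c `C ∙ t) _ = refl
Opt-S' (u₁ ∙ u₂) a (c `S' ∙ t) _ = refl
Opt-S' (u₁ ∙ u₂) a (c `B' ∙ t) _ = refl
Opt-S' (u₁ ∙ u₂) a (c `C' ∙ t) _ = refl
Opt-S' (u₁ ∙ u₂) a (t₁ ∙ t₂ ∙ t) _ = refl
Opt-S' (v y) a (v y') _ = refl
Opt-S' (v y) a (c k') _ = refl
Opt-S' (v y) a (v y' ∙ t) _ = refl
Opt-S' (v y) a (c `S ∙ t) _ = refl
Opt-S' (v y) a (c `K ∙ t) ()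
Opt-S' (v y) a (c `I ∙ t) _ = refl
Opt-S' (v y) a (c `B ∙ t) _ = refl
Opt-S' (v y) a (c `C ∙ t) _ = refl
Opt-S' (v y) a (c `S' ∙ t) _ = refl
Opt-S' (v y) a (c `B' ∙ t) _ = refl
Opt-S' (v y) a (c `C' ∙ t) _ = refl
Opt-S' (v y) a (t₁ ∙ t₂ ∙ t) _ = refl
Opt-S' (c k) a (v y') _ = refl
Opt-S' (c k) a (c k') _ = refl
Opt-S' (c k) a (v y' ∙ t) _ = refl
Opt-S' (c k) a (c `S ∙ t) _ = refl
Opt-S' (c k) a (c `K ∙ t) ()
Opt-S' (c k) a (c `I ∙ t) _ = refl
Opt-S' (c k) a (c `B ∙ t) _ = refl
Opt-S' (c k) a (c `C ∙ t) _ = refl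
Opt-S' (c k) a (c `S' ∙ t) _ = refl
Opt-S' (c k) a (c `B' ∙ t) _ = refl
Opt-S' (c k) a (c `C' ∙ t) _ = refl
Opt-S' (c k) a (t₁ ∙ t₂ ∙ t) _ = refl

by-cases : ∀ {A : Set} b → (b ≡ true → A) → (b ≡ false → A) → A
by-cases true  t f = t refl
by-cases false t f = f refl

∨-resolveʳ : ∀ {a b} → a ≡ false → a ∨ b ≡ true → b ≡ true
∨-resolveʳ refl e = e

if-preserves : (P : CL → Set) (b : Bool) {p q : CL} → P p → P q → P (if b then p else q)
if-preserves P true  Pp Pq = Pp
if-preserves P false Pp Pq = Pq

isVariable : CL → Bool
isVariable (v _) = true
isVariable _     = false

isVar⇒isVariable : ∀ x t → isVar x t ≡ true → isVariable t ≡ true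
isVar⇒isVariable x (v y) e = refl
isVar⇒isVariable x (c k) ()

isVar⇒occ : ∀ x t → isVar x t ≡ true → occ x t ≡ true
isVar⇒occ x (v y) e = e
isVar⇒occ x (c k) ()

¬occ⇒¬isVar : ∀ x t → occ x t ≡ false → isVar x t ≡ false
¬occ⇒¬isVar x (v y)   e = e
¬occ⇒¬isVar x (c k)   e = refl
¬occ⇒¬isVar x (s ∙ t) e = refl

-- For x ∈ FV (s t), this decides between rules (4)–(8) and rules (10)/(11) of T.
occFun : Var → CL → Bool
occFun x (s ∙ _) = occ x s
occFun x t       = occ x t

absT-∉ : ∀ x t → occ x t ≡ false → absT x t ≡ c `K ∙ t
absT-∉ x t e rewrite e = refl

absT-var : ∀ x t → isVar x t ≡ true → absT x t ≡ c `I
absT-var x (v y) e rewrite e = refl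
absT-var x (c k) ()

absT-occ-≡ : ∀ x t → occ x t ≡ true → absT x t ≡ absT-occ x t
absT-occ-≡ x t e rewrite e = refl

absT-η : ∀ x s t → occ x s ≡ false → isVar x t ≡ true → absT x (s ∙ t) ≡ s
absT-η x s t es vt rewrite es | isVar⇒occ x t vt | vt = refl

absT-B : ∀ x s t → occ x s ≡ false → occ x t ≡ true → isVar x t ≡ false →
         absT x (s ∙ t) ≡ composeB s (absT x t)
absT-B x (u ∙ s) t eus et vt
  rewrite ∨-conicalˡ (occ x u) _ eus | ∨-conicalʳ (occ x u) (occ x s) eus | et | vt
        | ¬occ⇒¬isVar x s (∨-conicalʳ (occ x u) _ eus) = refl
absT-B x (v y)   t es et vt rewrite es | et | vt = refl
absT-B x (c k)   t es et vt rewrite et | vt = refl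

absT-Cη : ∀ x u s t → occ x u ≡ false → isVar x s ≡ true → occ x t ≡ false →
          absT x (u ∙ s ∙ t) ≡ c `C ∙ u ∙ t
absT-Cη x u s t eu vs et
  rewrite eu | isVar⇒occ x s vs | et | ¬occ⇒¬isVar x t et | vs = refl

absT-Sη : ∀ x u s t → occ x u ≡ false → isVar x s ≡ true → occ x t ≡ true →
          absT x (u ∙ s ∙ t) ≡ c `S ∙ u ∙ absT x t
absT-Sη x u s t eu vs et rewrite eu | isVar⇒occ x s vs | et | vs with isVar x t
... | true  = refl
... | false = refl

absT-C' : ∀ x u s t → occ x u ≡ false → occ x s ≡ true → isVar x s ≡ false →
          occ x t ≡ false →
          absT x (u ∙ s ∙ t) ≡ c `C' ∙ u ∙ absT x s ∙ t
absT-C' x u s t eu es vs et rewrite eu | es | vs | et | ¬occ⇒¬isVar x t et = refl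

absT-S' : ∀ x u s t → occ x u ≡ false → occ x s ≡ true → isVar x s ≡ false →
          occ x t ≡ true →
          absT x (u ∙ s ∙ t) ≡ c `S' ∙ u ∙ absT x s ∙ absT x t
absT-S' x u s t eu es vs et rewrite eu | es | vs | et with isVar x t
... | true  = refl
... | false = refl

absT-C : ∀ x s t → occFun x s ≡ true → occ x t ≡ false →
         absT x (s ∙ t) ≡ c `C ∙ absT x s ∙ t
absT-C x (v y)   t ef et rewrite ef | et | ¬occ⇒¬isVar x t et = refl
absT-C x (u ∙ s) t ef et rewrite ef | et | ¬occ⇒¬isVar x t et with isVar x s
... | true  = refl
... | false = refl

absT-S : ∀ x s t → occFun x s ≡ true → occ x t ≡ true →
         absT x (s ∙ t) ≡ c `S ∙ absT x s ∙ absT x t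
absT-S x (v y)   t ef et rewrite ef | et with isVar x t
... | true  = refl
... | false = refl
absT-S x (u ∙ s) t ef et rewrite ef | et with isVar x s | isVar x t
... | true  | true  = refl
... | true  | false = refl
... | false | true  = refl
... | false | false = refl

OptOpaque : CL → Set
OptOpaque s = optRedexˡ s ∨ isI s ≡ false

Good : CL → Set
Good (v _)   = ⊤
Good (c _)   = ⊤
Good (s ∙ t) = Good s × Good t × (isVariable t ≡ true → OptOpaque s)

good-B : ∀ {s t} → Good s → Good t → Good (c `B ∙ s ∙ t)
good-B gs gt = (tt , gs , λ _ → refl) , gt , λ _ → refl

good-C : ∀ {s t} → Good s → Good t → Good (c `C ∙ s ∙ t)
good-C gs gt = (tt , gs , λ _ → refl) , gt , λ _ → refl

good-S : ∀ {s t} → Good s → Good t → Good (c `S ∙ s ∙ t)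
good-S gs gt = (tt , gs , λ _ → refl) , gt , λ _ → refl

good-B' : ∀ {r s t} → Good r → Good s → Good t → Good (c `B' ∙ r ∙ s ∙ t)
good-B' gr gs gt = ((tt , gr , λ _ → refl) , gs , λ _ → refl) , gt , λ _ → refl

good-C' : ∀ {r s t} → Good r → Good s → Good t → Good (c `C' ∙ r ∙ s ∙ t)
good-C' gr gs gt = ((tt , gr , λ _ → refl) , gs , λ _ → refl) , gt , λ _ → refl

good-S' : ∀ {r s t} → Good r → Good s → Good t → Good (c `S' ∙ r ∙ s ∙ t)
good-S' gr gs gt = ((tt , gr , λ _ → refl) , gs , λ _ → refl) , gt , λ _ → refl

mutual
  absT-good : ∀ x t → Good t → Good (absT x t)
  absT-good x t g =
    if-preserves Good (not (occ x t)) (tt , g , λ _ → refl) (absT-occ-good x t g)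

  absT-occ-good : ∀ x t → Good t → Good (absT-occ x t)
  absT-occ-good x (v y)   g             = tt
  absT-occ-good x (c k)   g             = tt , tt , λ _ → refl
  absT-occ-good x (s ∙ t) (gs , gt , _) =
    if-preserves Good (isVar x t ∧ not (occ x s)) gs (absT-app2-good x s t gs gt)

  absT-app2-good : ∀ x s t → Good s → Good t → Good (absT-app2 x s t)
  absT-app2-good x (u ∙ s) t g@(gu , gs , _) gt =
    if-preserves Good (isVar x s ∧ not (occ x u ∨ occ x t)) (good-C gu gt)
    (if-preserves Good (isVar x s ∧ not (occ x u)) (good-S gu (absT-good x t gt))
    (if-preserves Good (not (occ x u ∨ occ x s)) (good-B' gu gs (absT-good x t gt))
    (if-preserves Good (not (occ x u ∨ occ x t)) (good-C' gu (absT-good x s gs) gt)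
    (if-preserves Good (not (occ x u)) (good-S' gu (absT-good x s gs) (absT-good x t gt))
    (absT-app1-good x (u ∙ s) t g gt)))))
  absT-app2-good x (v y) t gs gt = absT-app1-good x (v y) t gs gt
  absT-app2-good x (c k) t gs gt = absT-app1-good x (c k) t gs gt

  absT-app1-good : ∀ x s t → Good s → Good t → Good (absT-app1 x s t)
  absT-app1-good x s t gs gt =
    if-preserves Good (not (occ x s)) (good-B gs (absT-good x t gt))
    (if-preserves Good (not (occ x t)) (good-C (absT-good x s gs) gt)
    (good-S (absT-good x s gs) (absT-good x t gt)))

Good-var-app : ∀ x u s → Good (u ∙ s) → isVar x s ≡ true → OptOpaque u
Good-var-app x u s (_ , _ , o) vs = o (isVar⇒isVariable x s vs)

Good-var-app-¬optRedexˡ : ∀ x u s → Good (u ∙ s) → isVar x s ≡ true →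
                          optRedexˡ u ≡ false
Good-var-app-¬optRedexˡ x u s g vs = ∨-conicalˡ (optRedexˡ u) _ (Good-var-app x u s g vs)

OptOpaque⇒¬isKOrI : ∀ s → OptOpaque s → isKOrI s ≡ false
OptOpaque⇒¬isKOrI s o =
  cong₂ _∨_ (∨-conicalˡ (isKApp s) _ (∨-conicalˡ (optRedexˡ s) _ o))
            (∨-conicalʳ (optRedexˡ s) _ o)

absT-app1-¬isKOrI : ∀ x s t → isKOrI (absT-app1 x s t) ≡ false
absT-app1-¬isKOrI x s t =
  if-preserves P (not (occ x s)) refl (if-preserves P (not (occ x t)) refl refl)
  where P = λ z → isKOrI z ≡ false

absT-app2-¬isKOrI : ∀ x s t → isKOrI (absT-app2 x s t) ≡ false
absT-app2-¬isKOrI x (u ∙ s) t =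
  if-preserves P (isVar x s ∧ not (occ x u ∨ occ x t)) refl
  (if-preserves P (isVar x s ∧ not (occ x u)) refl
  (if-preserves P (not (occ x u ∨ occ x s)) refl
  (if-preserves P (not (occ x u ∨ occ x t)) refl
  (if-preserves P (not (occ x u)) refl
  (absT-app1-¬isKOrI x (u ∙ s) t)))))
  where P = λ z → isKOrI z ≡ false
absT-app2-¬isKOrI x (v y) t = absT-app1-¬isKOrI x (v y) t
absT-app2-¬isKOrI x (c k) t = absT-app1-¬isKOrI x (c k) t

absT-¬isKOrI : ∀ x t → Good t → occ x t ≡ true → isVar x t ≡ false →
               isKOrI (absT x t) ≡ false
absT-¬isKOrI x (v y) g et vt with trans (sym et) vt
... | ()
absT-¬isKOrI x (c k) g () vt
absT-¬isKOrI x (s ∙ t) g et vt rewrite absT-occ-≡ x (s ∙ t) et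
  with isVar x t ∧ not (occ x s) in e
... | true  = OptOpaque⇒¬isKOrI s (Good-var-app x s t g (∧-conicalˡ _ _ e))
... | false = absT-app2-¬isKOrI x s t

absT-¬isKApp : ∀ x t → Good t → occ x t ≡ true → isKApp (absT x t) ≡ false
absT-¬isKApp x t g et with isVar x t in vt
... | true  rewrite absT-var x t vt = refl
... | false = ∨-conicalˡ _ _ (absT-¬isKOrI x t g et vt)

occ-¬occFun⇒absT-¬optRedexˡ : ∀ x u s → occ x u ≡ true → occFun x u ≡ false →
                               optRedexˡ (absT x (u ∙ s)) ≡ false
occ-¬occFun⇒absT-¬optRedexˡ x (v y) s eu ef with trans (sym eu) ef
... | ()
occ-¬occFun⇒absT-¬optRedexˡ x (c k) s () ef
occ-¬occFun⇒absT-¬optRedexˡ x (u₁ ∙ u₂) s eu ef = by-cases (isVar x u₂)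
  (λ v₂ → by-cases (occ x s)
    (λ es → cong optRedexˡ (absT-Sη x u₁ u₂ s ef v₂ es))
    (λ es → cong optRedexˡ (absT-Cη x u₁ u₂ s ef v₂ es)))
  (λ v₂ → by-cases (occ x s)
    (λ es → cong optRedexˡ (absT-S' x u₁ u₂ s ef (∨-resolveʳ ef eu) v₂ es))
    (λ es → cong optRedexˡ (absT-C' x u₁ u₂ s ef (∨-resolveʳ ef eu) v₂ es)))

occFun⇒absT-¬optRedexˡ : ∀ x s → occFun x s ≡ true → optRedexˡ (absT x s) ≡ false
occFun⇒absT-¬optRedexˡ x (v y)   ef rewrite ef = refl
occFun⇒absT-¬optRedexˡ x (c k)   ()
occFun⇒absT-¬optRedexˡ x (u ∙ s) eu = by-cases (occFun x u)
  (λ ef → by-cases (occ x s)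
    (λ es → cong optRedexˡ (absT-S x u s ef es))
    (λ es → cong optRedexˡ (absT-C x u s ef es)))
  (occ-¬occFun⇒absT-¬optRedexˡ x u s eu)

absT-app-∉∈ : ∀ x s t → Good t → occ x s ≡ false → occ x t ≡ true →
              absT x (s ∙ t) ≡ optS (absT x s) (absT x t)
absT-app-∉∈ x s t gt es et = by-cases (isVar x t)
  (λ vt → begin
    absT x (s ∙ t)              ≡⟨ absT-η x s t es vt ⟩
    optS (c `K ∙ s) (c `I)      ≡⟨ sym (cong₂ optS (absT-∉ x s es) (absT-var x t vt)) ⟩
    optS (absT x s) (absT x t)  ∎)
  (λ vt → begin
    absT x (s ∙ t)              ≡⟨ absT-B x s t es et vt ⟩
    composeB s (absT x t)       ≡⟨ sym (Opt-B s _ (absT-¬isKOrI x t gt et vt)) ⟩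
    optS (c `K ∙ s) (absT x t)  ≡⟨ sym (cong (λ a → optS a (absT x t)) (absT-∉ x s es)) ⟩
    optS (absT x s) (absT x t)  ∎)

absT-app-C : ∀ x s t → occFun x s ≡ true → occ x t ≡ false →
             absT x (s ∙ t) ≡ optS (absT x s) (absT x t)
absT-app-C x s t ef et = begin
  absT x (s ∙ t)              ≡⟨ absT-C x s t ef et ⟩
  c `C ∙ absT x s ∙ t         ≡⟨ sym (Opt-C (absT x s) t (occFun⇒absT-¬optRedexˡ x s ef)) ⟩
  optS (absT x s) (c `K ∙ t)  ≡⟨ sym (cong (optS (absT x s)) (absT-∉ x t et)) ⟩
  optS (absT x s) (absT x t)  ∎

absT-app-S : ∀ x s t → Good t → occFun x s ≡ true → occ x t ≡ true →
             absT x (s ∙ t) ≡ optS (absT x s) (absT x t)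
absT-app-S x s t gt ef et = begin
  absT x (s ∙ t)              ≡⟨ absT-S x s t ef et ⟩
  c `S ∙ absT x s ∙ absT x t  ≡⟨ sym (Opt-S (absT x s) (absT x t)
                                   (occFun⇒absT-¬optRedexˡ x s ef) (absT-¬isKApp x t gt et)) ⟩
  optS (absT x s) (absT x t)  ∎

absT-app-∈∉ : ∀ x s t → Good s → occ x s ≡ true → occ x t ≡ false →
              absT x (s ∙ t) ≡ optS (absT x s) (absT x t)
absT-app-∈∉ x (v y)   t g es  et = absT-app-C x (v y) t es et
absT-app-∈∉ x (c k)   t g ()  et
absT-app-∈∉ x (u ∙ s) t g eus et = by-cases (occ x u)
  (λ eu → absT-app-C x (u ∙ s) t eu et)
  (λ eu → by-cases (isVar x s)
    (λ vs → begin
      absT x (u ∙ s ∙ t)                ≡⟨ absT-Cη x u s t eu vs et ⟩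
      c `C ∙ u ∙ t                      ≡⟨ sym (Opt-C u t (Good-var-app-¬optRedexˡ x u s g vs)) ⟩
      optS u (c `K ∙ t)                 ≡⟨ sym (cong₂ optS (absT-η x u s eu vs) (absT-∉ x t et)) ⟩
      optS (absT x (u ∙ s)) (absT x t)  ∎)
    (λ vs → let es = ∨-resolveʳ eu eus in begin
      absT x (u ∙ s ∙ t)                       ≡⟨ absT-C' x u s t eu es vs et ⟩
      c `C' ∙ u ∙ absT x s ∙ t                 ≡⟨ sym (Opt-C' u (absT x s) t) ⟩
      optS (composeB u (absT x s)) (c `K ∙ t)
        ≡⟨ sym (cong₂ optS (absT-B x u s eu es vs) (absT-∉ x t et)) ⟩
      optS (absT x (u ∙ s)) (absT x t)         ∎))

absT-app-∈∈ : ∀ x s t → Good s → Good t → occ x s ≡ true → occ x t ≡ true →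
              absT x (s ∙ t) ≡ optS (absT x s) (absT x t)
absT-app-∈∈ x (v y)   t gs gt es  et = absT-app-S x (v y) t gt es et
absT-app-∈∈ x (c k)   t gs gt ()  et
absT-app-∈∈ x (u ∙ s) t gs gt eus et = by-cases (occ x u)
  (λ eu → absT-app-S x (u ∙ s) t gt eu et)
  (λ eu → by-cases (isVar x s)
    (λ vs → begin
      absT x (u ∙ s ∙ t)                ≡⟨ absT-Sη x u s t eu vs et ⟩
      c `S ∙ u ∙ absT x t               ≡⟨ sym (Opt-S u (absT x t)
                                             (Good-var-app-¬optRedexˡ x u s gs vs)
                                             (absT-¬isKApp x t gt et)) ⟩
      optS u (absT x t)                 ≡⟨ sym (cong (λ a → optS a (absT x t)) (absT-η x u s eu vs)) ⟩
      optS (absT x (u ∙ s)) (absT x t)  ∎)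
    (λ vs → let es = ∨-resolveʳ eu eus in begin
      absT x (u ∙ s ∙ t)                       ≡⟨ absT-S' x u s t eu es vs et ⟩
      c `S' ∙ u ∙ absT x s ∙ absT x t          ≡⟨ sym (Opt-S' u (absT x s) (absT x t)
                                                    (absT-¬isKApp x t gt et)) ⟩
      optS (composeB u (absT x s)) (absT x t)
        ≡⟨ sym (cong (λ a → optS a (absT x t)) (absT-B x u s eu es vs)) ⟩
      optS (absT x (u ∙ s)) (absT x t)         ∎))

absT-app : ∀ x s t → Good (s ∙ t) → absT x (s ∙ t) ≡ optS (absT x s) (absT x t)
absT-app x s t (gs , gt , _) = by-cases (occ x s)
  (λ es → by-cases (occ x t) (absT-app-∈∈ x s t gs gt es) (absT-app-∈∉ x s t gs es))
  (λ es → by-cases (occ x t) (absT-app-∉∈ x s t gt es)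
    (λ et → begin
      absT x (s ∙ t)              ≡⟨ absT-∉ x (s ∙ t) (cong₂ _∨_ es et) ⟩
      optS (c `K ∙ s) (c `K ∙ t)  ≡⟨ sym (cong₂ optS (absT-∉ x s es) (absT-∉ x t et)) ⟩
      optS (absT x s) (absT x t)  ∎))

absT≡absT' : ∀ x t → Good t → absT x t ≡ absT' x t
absT≡absT' x (v y) _ with x ≡ᵇ y
... | true  = refl
... | false = refl
absT≡absT' x (c k) _ = refl
absT≡absT' x (s ∙ t) g@(gs , gt , _) =
  trans (absT-app x s t g) (cong₂ optS (absT≡absT' x s gs) (absT≡absT' x t gt))

data VarHeaded : CL → Set where
  var : ∀ y → VarHeaded (v y)
  app : ∀ {s} t → VarHeaded s → VarHeaded (s ∙ t)

VarHeaded⇒OptOpaque : ∀ {s} → VarHeaded s → OptOpaque s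
VarHeaded⇒OptOpaque (var y)                           = refl
VarHeaded⇒OptOpaque (app _ (var y))                   = refl
VarHeaded⇒OptOpaque (app _ (app _ (var y)))           = refl
VarHeaded⇒OptOpaque (app _ (app _ (app _ (var y))))   = refl
VarHeaded⇒OptOpaque (app _ (app _ (app _ (app _ _)))) = refl

mutual
  ⟦T⟧-neutral : ∀ {t} → Neutral t → VarHeaded (⟦T⟧ t) × Good (⟦T⟧ t)
  ⟦T⟧-neutral (ne-var x) = var x , tt
  ⟦T⟧-neutral (ne-app {t = t} ns nt) with ⟦T⟧-neutral ns
  ... | h , g = app (⟦T⟧ t) h , g , ⟦T⟧-good nt , λ _ → VarHeaded⇒OptOpaque h

  ⟦T⟧-good : ∀ {t} → Normal t → Good (⟦T⟧ t)
  ⟦T⟧-good (nf-ne n)    = proj₂ (⟦T⟧-neutral n)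
  ⟦T⟧-good (nf-lam x n) = absT-good x _ (⟦T⟧-good n)

mutual
  ⟦T⟧≡⟦T'⟧-neutral : ∀ {t} → Neutral t → ⟦T⟧ t ≡ ⟦T'⟧ t
  ⟦T⟧≡⟦T'⟧-neutral (ne-var x)   = refl
  ⟦T⟧≡⟦T'⟧-neutral (ne-app s t) = cong₂ _∙_ (⟦T⟧≡⟦T'⟧-neutral s) (⟦T⟧≡⟦T'⟧-normal t)

  ⟦T⟧≡⟦T'⟧-normal : ∀ {t} → Normal t → ⟦T⟧ t ≡ ⟦T'⟧ t
  ⟦T⟧≡⟦T'⟧-normal (nf-ne n)        = ⟦T⟧≡⟦T'⟧-neutral n
  ⟦T⟧≡⟦T'⟧-normal (nf-lam x {t} n) =
    trans (absT≡absT' x (⟦T⟧ t) (⟦T⟧-good n)) (cong (absT' x) (⟦T⟧≡⟦T'⟧-normal n))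

mainTheorem1 : (t : Λ) → Normal t → ⟦T⟧ t ≡ ⟦T'⟧ t
mainTheorem1 _ = ⟦T⟧≡⟦T'⟧-normal
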